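{- Fix $k,l,m,n\in\mathbb Z^2$. For $N$ an odd prime let $X$ be the set of triples $(B_2,B_3,B_4)\in C(2N)^3$ with $$k-lB_2+mB_3-nB_4\equiv0\bmod N .$$ If $Q(k),Q(l),Q(m),Q(n)\not\equiv0\bmod N$, then $|X|\le 3(N+1)$ for $N$ sufficiently large.
   Context: Let $A=\begin{pmatrix}a&b\\c&d\end{pmatrix}\in SL(2,\mathbb Z)$ be hyperbolic with $A\equiv I\bmod 2$, $Q(x,y)=cx^2+(d-a)xy-by^2$. Vectors are row vectors and matrices act on the right. With $\alpha$ an eigenvalue of $A$ and $\mathcal O=\mathbb Z[\alpha]$, the ideal $\mathbb Zc+\mathbb Z(\alpha-a)$ with this basis is identified with $\mathbb Z^2$, and multiplication gives $\iota:\mathcal O\to M_2(\mathbb Z)$ with $\iota(\alpha)=A$ and $\det\iota(\beta)$ the norm of $\beta$. $C(2N)$ is the group of elements of $\mathcal O/2N\mathcal O$ of norm $\equiv1\bmod2N$ and $\equiv1\bmod2\mathcal O$; via $\iota$ reduced mod $2N$ it is identified with $\{B\in SO(Q,\mathbb Z/2N\mathbb Z):B\equiv I\bmod 2\}$, and elements act on $(\mathbb Z/N\mathbb Z)^2$ through reduction mod $N$. -}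

module Defs where

open import Data.Nat as ℕ using (ℕ)
open import Data.Integer using (ℤ; +_; _+_; _-_; _*_; ∣_∣; 0ℤ; 1ℤ)
open import Data.Integer.Divisibility using (_∣_)
open import Data.Fin using (Fin; toℕ)
open import Data.Product using (_×_; _,_; proj₁; proj₂)
open import Data.List using (List; length)
open import Data.List.Relation.Unary.All using (All)
open import Data.List.Relation.Unary.Unique.Propositional using (Unique)
open import Relation.Binary.PropositionalEquality using (_≡_)

_≡_[mod_] : ℤ → ℤ → ℕ → Set
x ≡ y [mod m ] = (+ m) ∣ (x - y)

Vec2 : Set
Vec2 = ℤ × ℤ

record Mat2 : Set where
  constructor mat
  field
    a b c d : ℤ
open Mat2 public

_·_ : Vec2 → Mat2 → Vec2
(v₁ , v₂) · M = (v₁ * a M + v₂ * c M , v₁ * b M + v₂ * d M)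

vadd vsub : Vec2 → Vec2 → Vec2
vadd (x₁ , x₂) (y₁ , y₂) = (x₁ + y₁ , x₂ + y₂)
vsub (x₁ , x₂) (y₁ , y₂) = (x₁ - y₁ , x₂ - y₂)

_≡ᵥ_[mod_] : Vec2 → Vec2 → ℕ → Set
(x₁ , x₂) ≡ᵥ (y₁ , y₂) [mod N ] = (x₁ ≡ y₁ [mod N ]) × (x₂ ≡ y₂ [mod N ])

IsSL2 : Mat2 → Set
IsSL2 A = a A * d A - b A * c A ≡ 1ℤ

Hyperbolic : Mat2 → Set
Hyperbolic A = 2 ℕ.< ∣ a A + d A ∣

≡I-mod2 : Mat2 → Set
≡I-mod2 A = (a A ≡ 1ℤ [mod 2 ]) × (b A ≡ 0ℤ [mod 2 ]) ×
            (c A ≡ 0ℤ [mod 2 ]) × (d A ≡ 1ℤ [mod 2 ])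

Q : Mat2 → Vec2 → ℤ
Q A (x , y) = c A * x * x + (d A - a A) * x * y - b A * y * y

-- Elements of O = ℤ[α] are written x + yα, encoded as (x , y); O/2NO is
-- then (ℤ/2Nℤ)², with canonical representatives in Fin (2N).
-- Norm of x + yα : x² + tr(A) x y + y²  (α + α' = a + d, α α' = 1).
normO : Mat2 → ℤ × ℤ → ℤ
normO A (x , y) = x * x + (a A + d A) * x * y + y * y

-- ι(x + yα) = x I + y A, since ι is a ring map with ι(α) = A.
ι : Mat2 → ℤ × ℤ → Mat2
ι A (x , y) = mat (x + y * a A) (y * b A) (y * c A) (x + y * d A)

Res : ℕ → Set
Res N = Fin (2 ℕ.* N) × Fin (2 ℕ.* N)

lift : (N : ℕ) → Res N → ℤ × ℤ
lift N (x , y) = (+ toℕ x , + toℕ y)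

-- β ∈ C(2N): norm ≡ 1 mod 2N and β ≡ 1 mod 2O.
InC : (A : Mat2) (N : ℕ) → Res N → Set
InC A N β =
  (normO A (lift N β) ≡ 1ℤ [mod 2 ℕ.* N ]) ×
  (proj₁ (lift N β) ≡ 1ℤ [mod 2 ]) × (proj₂ (lift N β) ≡ 0ℤ [mod 2 ])

InX : (A : Mat2) (k l m n : Vec2) (N : ℕ) → Res N × Res N × Res N → Set
InX A k l m n N (β₂ , β₃ , β₄) =
  InC A N β₂ × InC A N β₃ × InC A N β₄ ×
  (vsub (vadd (vsub k (l · ι A (lift N β₂))) (m · ι A (lift N β₃)))
        (n · ι A (lift N β₄))
    ≡ᵥ (0ℤ , 0ℤ) [mod N ])

CardLe : {T : Set} → (T → Set) → ℕ → Set
CardLe {T} P s = (xs : List T) → Unique xs → All P xs → length xs ℕ.≤ s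

{-# OPTIONS --safe #-}
-- Write v = l B₂ - k, so that the defining congruence of X reads m B₃ - v ≡ n B₄ (mod N). An element
-- of C(2N) is determined by its reduction mod N (N is odd), a point β of the conic
-- x² + t x y + y² = 1 over 𝔽_N, t = tr A; projecting from (-1 , 0) shows that the conic has at most
-- N + 1 points when N ∤ t² - 4. For row vectors the binary form attached to A is
-- f (x , y) = b x² + (d - a) x y - c y², which satisfies f (w ι(β)) = Nm(β) f (w); the map
-- β ↦ w ι(β) is injective mod N when N ∤ f (w).
-- If v ≡ 0, then B₂ is determined, and B₃ determines B₄: at most N + 1 triples. Otherwise, applying f
-- to both sides of m B₃ - v ≡ n B₄ puts β₃ on a line, proper because N ∤ f (m) (t² - 4), which meets
-- the conic in at most two points: at most 2 (N + 1) triples.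
-- Since t² - 4 is not a square, f is anisotropic over ℤ; as Q(l) ≢ 0 forces l ≠ 0, f (l) ≠ 0, and
-- for N beyond |t² - 4|, |f (l)|, |f (m)|, |f (n)| all of these are nonzero mod N.
module Submission where

open import Data.Nat using (ℕ)
open import Data.Nat.Primality using (Prime)
open import Defs

module CardinalityBounds where

  open import Data.Nat using (ℕ; zero; suc; _+_; _*_; _≤_; z≤n; s≤s)
  open import Data.Nat.Properties using (+-suc; +-mono-≤; ≤-pred; _≤?_; ≰⇒>)
  open import Data.Fin using (Fin; zero; suc; _<_)
  open import Data.Fin.Properties using (pigeonhole)
  open import Data.List using (List; []; _∷_; length; map; filter; lookup)
  open import Data.List.Properties using (length-map)
  open import Data.List.Relation.Unary.All as All using (All; []; _∷_)
  open import Data.List.Relation.Unary.All.Properties using (map⁺; all-filter; filter⁺)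
  open import Data.List.Relation.Unary.AllPairs using ([]; _∷_)
  open import Data.List.Relation.Unary.Unique.Propositional using (Unique)
  import Data.List.Relation.Unary.Unique.Propositional.Properties as Unique
  open import Data.List.Membership.Propositional.Properties using (∈-lookup)
  open import Data.Product using (_×_; _,_; proj₁; proj₂)
  open import Data.Empty using (⊥; ⊥-elim)
  open import Data.Unit using (⊤)
  open import Function using (_∘_)
  open import Relation.Nullary using (yes; no; ¬?)
  open import Relation.Unary using (Decidable; _∩_; ∁)
  open import Relation.Binary using (DecidableEquality)
  open import Relation.Binary.PropositionalEquality

  private variable
    T : Set
    s r : ℕ

  cardLe-injection : {U : Set} {P : T → Set} {R : U → Set} (f : T → U) →
    (∀ {x} → P x → R (f x)) → (∀ {x y} → P x → P y → f x ≡ f y → x ≡ y) →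
    CardLe R s → CardLe P s
  cardLe-injection {P = P} f f-into f-inj bound xs xs-unique xs-P =
    subst (_≤ _) (length-map f xs)
      (bound (map f xs) (map-unique xs-P xs-unique) (map⁺ (All.map f-into xs-P)))
    where
    map-unique : ∀ {xs} → All P xs → Unique xs → Unique (map f xs)
    map-unique [] [] = []
    map-unique (px ∷ pxs) (x∉xs ∷ xs-unique) =
      map⁺ (All.zipWith (λ (py , x≢y) → x≢y ∘ f-inj px py) (pxs , x∉xs)) ∷ map-unique pxs xs-unique

  lookup-injective : {xs : List T} → Unique xs → ∀ {i j} → i < j → lookup xs i ≢ lookup xs j
  lookup-injective {xs = _ ∷ xs} (x∉xs ∷ _) {zero} {suc j} _ = All.lookup x∉xs (∈-lookup {xs = xs} j)
  lookup-injective (_ ∷ xs-unique) {suc i} {suc j} (s≤s i<j) = lookup-injective xs-unique i<j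

  cardLe-Fin : ∀ n → CardLe {Fin n} (λ _ → ⊤) n
  cardLe-Fin n xs xs-unique _ with length xs ≤? n
  ... | yes ≤n = ≤n
  ... | no ≰n with i , j , i<j , same ← pigeonhole (≰⇒> ≰n) (lookup xs) =
    ⊥-elim (lookup-injective xs-unique i<j same)

  cardLe-2 : {P : T → Set} →
    (∀ {x y z} → P x → P y → P z → x ≢ y → x ≢ z → y ≢ z → ⊥) → CardLe P 2
  cardLe-2 _ [] _ _ = z≤n
  cardLe-2 _ (_ ∷ []) _ _ = s≤s z≤n
  cardLe-2 _ (_ ∷ _ ∷ []) _ _ = s≤s (s≤s z≤n)
  cardLe-2 no-three (_ ∷ _ ∷ _ ∷ _) ((x≢y ∷ x≢z ∷ _) ∷ (y≢z ∷ _) ∷ _) (px ∷ py ∷ pz ∷ _) =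
    ⊥-elim (no-three px py pz x≢y x≢z y≢z)

  length-filter-∁ : {D : T → Set} (D? : Decidable D) (xs : List T) →
    length xs ≡ length (filter D? xs) + length (filter (¬? ∘ D?) xs)
  length-filter-∁ D? [] = refl
  length-filter-∁ D? (x ∷ xs) with D? x
  ... | yes _ = cong suc (length-filter-∁ D? xs)
  ... | no _ = trans (cong suc (length-filter-∁ D? xs)) (sym (+-suc _ _))

  cardLe-split : {P D : T → Set} (D? : Decidable D) →
    CardLe (P ∩ D) s → CardLe (P ∩ ∁ D) r → CardLe P (s + r)
  cardLe-split D? bound-D bound-∁D xs xs-unique xs-P =
    subst (_≤ _) (sym (length-filter-∁ D? xs))
      (+-mono-≤ (bound-D _ (Unique.filter⁺ D? xs-unique)
                   (All.zip (filter⁺ D? xs-P , all-filter D? xs)))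
                (bound-∁D _ (Unique.filter⁺ (¬? ∘ D?) xs-unique)
                   (All.zip (filter⁺ (¬? ∘ D?) xs-P , all-filter (¬? ∘ D?) xs))))

  cardLe-⊆ : {P R : T → Set} → (∀ {x} → P x → R x) → CardLe R s → CardLe P s
  cardLe-⊆ P⊆R = cardLe-injection (λ x → x) P⊆R (λ _ _ x≡y → x≡y)

  cardLe-fibres : {U W : Set} → DecidableEquality U → {P : U → Set} {R : U → W → Set} {b : ℕ} →
    CardLe P s → (∀ u → CardLe (R u) b) → CardLe (λ ((u , w) : U × W) → P u × R u w) (s * b)
  cardLe-fibres _≟_ _ _ [] _ _ = z≤n
  cardLe-fibres {s = zero} _≟_ bound-P _ ((u , _) ∷ _) _ ((pu , _) ∷ _)
    with () ← bound-P (u ∷ []) ([] ∷ []) (pu ∷ [])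
  cardLe-fibres {s = suc s} {U} {W} _≟_ {P} {R} bound-P bound-R xs@((u₀ , _) ∷ _) xs-unique xs-PR@((pu₀ , _) ∷ _) =
    cardLe-split (λ ((u , _) : U × W) → u ≟ u₀) fibre rest xs xs-unique xs-PR
    where
    fibre : CardLe (λ ((u , w) : U × W) → (P u × R u w) × u ≡ u₀) _
    fibre = cardLe-injection proj₂ (λ { ((_ , r) , refl) → r })
      (λ { (_ , refl) (_ , refl) refl → refl }) (bound-R u₀)
    P-without-u₀ : CardLe (λ u → P u × u ≢ u₀) s
    P-without-u₀ ys ys-unique ys-P = ≤-pred
      (bound-P (u₀ ∷ ys) (All.map (λ (_ , u≢u₀) → u≢u₀ ∘ sym) ys-P ∷ ys-unique) (pu₀ ∷ All.map proj₁ ys-P))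
    rest : CardLe (λ ((u , w) : U × W) → (P u × R u w) × u ≢ u₀) _
    rest = cardLe-⊆ (λ ((pu , r) , u≢u₀) → (pu , u≢u₀) , r) (cardLe-fibres _≟_ P-without-u₀ bound-R)

module NonSquare where

  open import Data.Nat as ℕ using (ℕ; zero; suc; z≤n; s≤s; _<_; _≤_)
  open import Data.Nat.Properties as ℕP using (≰⇒>; <⇒≱)
  open import Data.Nat.Induction using (<-rec)
  open import Data.Integer as ℤ using (ℤ; +_; _+_; _-_; _*_; ∣_∣)
  import Data.Integer.Properties as ℤP
  open import Data.Integer.Tactic.RingSolver using (solve-∀)
  import Data.Nat.Tactic.RingSolver as ℕ-Solver
  open import Data.Empty using (⊥-elim)
  open import Data.Product using (∃; _×_; _,_; proj₁; proj₂)
  open import Relation.Binary.PropositionalEquality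

  squares-<⇒< : ∀ {m n} → m ℕ.* m < n ℕ.* n → m < n
  squares-<⇒< m²<n² = ≰⇒> λ n≤m → <⇒≱ m²<n² (ℕP.*-mono-≤ n≤m n≤m)

  pos-D*y² : ∀ D y → + D * (+ y * + y) ≡ + (D ℕ.* (y ℕ.* y))
  pos-D*y² D y = trans (cong (+ D *_) (sym (ℤP.pos-* y y))) (sym (ℤP.pos-* D (y ℕ.* y)))

  module _ {q D : ℕ} (q²<D : q ℕ.* q < D) (D<[q+1]² : D < suc q ℕ.* suc q) where

    private
      square-* : ∀ m n → (m ℕ.* n) ℕ.* (m ℕ.* n) ≡ (m ℕ.* m) ℕ.* (n ℕ.* n)
      square-* = ℕ-Solver.solve-∀

      descent-identity : ∀ (D Y q M : ℤ) → (D * Y - q * M) * (D * Y - q * M) ≡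
        D * ((M - q * Y) * (M - q * Y)) + (D - q * q) * (D * (Y * Y) - M * M)
      descent-identity = solve-∀

    qy<m<[q+1]y : ∀ {m y} .{{_ : ℕ.NonZero y}} → m ℕ.* m ≡ D ℕ.* (y ℕ.* y) →
      q ℕ.* y < m × m < suc q ℕ.* y
    qy<m<[q+1]y {m} {y@(suc _)} m²≡Dy² = squares-<⇒< (begin-strict
      (q ℕ.* y) ℕ.* (q ℕ.* y)             ≡⟨ square-* q y ⟩
      (q ℕ.* q) ℕ.* (y ℕ.* y)             <⟨ ℕP.*-monoˡ-< (y ℕ.* y) q²<D ⟩
      D ℕ.* (y ℕ.* y)                     ≡⟨ m²≡Dy² ⟨
      m ℕ.* m                             ∎) , squares-<⇒< (begin-strict
      m ℕ.* m                             ≡⟨ m²≡Dy² ⟩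
      D ℕ.* (y ℕ.* y)                     <⟨ ℕP.*-monoˡ-< (y ℕ.* y) D<[q+1]² ⟩
      (suc q ℕ.* suc q) ℕ.* (y ℕ.* y)     ≡⟨ square-* (suc q) y ⟨
      (suc q ℕ.* y) ℕ.* (suc q ℕ.* y)     ∎)
      where open ℕP.≤-Reasoning

    descent : ∀ {m y} → m ℕ.* m ≡ D ℕ.* (y ℕ.* y) → q ℕ.* y ℕ.≤ m →
      (+ D * + y - + q * + m) * (+ D * + y - + q * + m) ≡ + D * (+ (m ℕ.∸ q ℕ.* y) * + (m ℕ.∸ q ℕ.* y))
    descent {m} {y} m²≡Dy² qy≤m = begin
      (+ D * + y - + q * + m) * (+ D * + y - + q * + m)        ≡⟨ descent-identity (+ D) (+ y) (+ q) (+ m) ⟩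
      + D * (m-qy * m-qy) + (+ D - + q * + q) * (+ D * (+ y * + y) - + m * + m)
        ≡⟨ cong₂ (λ u v → + D * (u * u) + (+ D - + q * + q) * v) (sym y'≡m-qy) Dy²-m²≡0 ⟩
      + D * (+ y' * + y') + (+ D - + q * + q) * + 0
        ≡⟨ cong (_+_ (+ D * (+ y' * + y'))) (ℤP.*-zeroʳ (+ D - + q * + q)) ⟩
      + D * (+ y' * + y') + + 0                              ≡⟨ ℤP.+-identityʳ _ ⟩
      + D * (+ y' * + y')                                    ∎
      where
      open ≡-Reasoning
      y' = m ℕ.∸ q ℕ.* y
      m-qy = + m - + q * + y
      y'≡m-qy : + y' ≡ m-qy
      y'≡m-qy = begin
        + (m ℕ.∸ q ℕ.* y)   ≡⟨ ℤP.⊖-≥ qy≤m ⟨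
        m ℤ.⊖ (q ℕ.* y)     ≡⟨ ℤP.m-n≡m⊖n m (q ℕ.* y) ⟨
        + m - + (q ℕ.* y)   ≡⟨ cong (λ k → + m - k) (ℤP.pos-* q y) ⟩
        + m - + q * + y     ∎
      Dy²-m²≡0 : + D * (+ y * + y) - + m * + m ≡ + 0
      Dy²-m²≡0 = begin
        + D * (+ y * + y) - + m * + m     ≡⟨ cong₂ _-_ (pos-D*y² D y) (sym (ℤP.pos-* m m)) ⟩
        + (D ℕ.* (y ℕ.* y)) - + (m ℕ.* m) ≡⟨ cong (λ k → + k - + (m ℕ.* m)) m²≡Dy² ⟨
        + (m ℕ.* m) - + (m ℕ.* m)         ≡⟨ ℤP.+-inverseʳ (+ (m ℕ.* m)) ⟩
        + 0                               ∎

    -- Infinite descent: (D y - q m, m - q y) is again a solution, and 0 < m - q y < y.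
    n²≡Dy²⇒y≡0 : ∀ y (n : ℤ) → n * n ≡ + D * (+ y * + y) → y ≡ 0
    n²≡Dy²⇒y≡0 = <-rec _ step
      where
      step : ∀ y → (∀ {y'} → y' < y → ∀ (n : ℤ) → n * n ≡ + D * (+ y' * + y') → y' ≡ 0) →
             ∀ (n : ℤ) → n * n ≡ + D * (+ y * + y) → y ≡ 0
      step zero _ _ _ = refl
      step y@(suc _) smaller n n²≡Dy² = ⊥-elim (<⇒≱ qy<m (ℕP.m∸n≡0⇒m≤n y'≡0))
        where
        m²≡Dy² : ∣ n ∣ ℕ.* ∣ n ∣ ≡ D ℕ.* (y ℕ.* y)
        m²≡Dy² = trans (sym (ℤP.abs-* n n)) (cong ∣_∣ (trans n²≡Dy² (pos-D*y² D y)))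
        qy<m = proj₁ (qy<m<[q+1]y m²≡Dy²)
        y'<y : ∣ n ∣ ℕ.∸ q ℕ.* y < y
        y'<y = ℕP.m<n+o⇒m∸n<o ∣ n ∣ (q ℕ.* y)
          (subst (∣ n ∣ <_) (ℕP.+-comm y (q ℕ.* y)) (proj₂ (qy<m<[q+1]y m²≡Dy²)))
        y'≡0 = smaller y'<y (+ D * + y - + q * + ∣ n ∣) (descent m²≡Dy² (ℕP.<⇒≤ qy<m))

  square-abs : ∀ t → t * t ≡ + ∣ t ∣ * + ∣ t ∣
  square-abs (+ n) = refl
  square-abs ℤ.-[1+ n ] = refl

  s²-4-between-squares : ∀ s → 2 < s →
    ∃ λ q → ∃ λ D → q ℕ.* q < D × D < suc q ℕ.* suc q × + s * + s - + 4 ≡ + D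
  s²-4-between-squares 1 (s≤s ())
  s²-4-between-squares 2 (s≤s (s≤s ()))
  s²-4-between-squares s@(suc (suc (suc r))) _ = q , D , q²<D , D<[q+1]² , s²-4≡D
    where
    q = suc (suc r)
    D = r ℕ.* r ℕ.+ 6 ℕ.* r ℕ.+ 5
    D≡q²+2r+1 : D ≡ suc (q ℕ.* q ℕ.+ 2 ℕ.* r)
    D≡q²+2r+1 = identity r
      where
      identity : ∀ r → r ℕ.* r ℕ.+ 6 ℕ.* r ℕ.+ 5 ≡ suc (suc (suc r) ℕ.* suc (suc r) ℕ.+ 2 ℕ.* r)
      identity = ℕ-Solver.solve-∀
    s²≡4+D : s ℕ.* s ≡ 4 ℕ.+ D
    s²≡4+D = identity r
      where
      identity : ∀ r → suc (suc (suc r)) ℕ.* suc (suc (suc r)) ≡ 4 ℕ.+ (r ℕ.* r ℕ.+ 6 ℕ.* r ℕ.+ 5)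
      identity = ℕ-Solver.solve-∀
    q²<D : q ℕ.* q < D
    q²<D = subst (q ℕ.* q <_) (sym D≡q²+2r+1) (s≤s (ℕP.m≤m+n (q ℕ.* q) (2 ℕ.* r)))
    D<[q+1]² : D < s ℕ.* s
    D<[q+1]² = subst (D <_) (sym s²≡4+D) (ℕP.m<n+m D {4} (s≤s z≤n))
    s²-4≡D : + s * + s - + 4 ≡ + D
    s²-4≡D = begin
      + s * + s - + 4      ≡⟨ cong (_- + 4) (ℤP.pos-* s s) ⟨
      + (s ℕ.* s) - + 4    ≡⟨ ℤP.m-n≡m⊖n (s ℕ.* s) 4 ⟩
      (s ℕ.* s) ℤ.⊖ 4      ≡⟨ ℤP.⊖-≥ (subst (4 ≤_) (sym s²≡4+D) (ℕP.m≤m+n 4 D)) ⟩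
      + (s ℕ.* s ℕ.∸ 4)    ≡⟨ cong (λ k → + (k ℕ.∸ 4)) s²≡4+D ⟩
      + (4 ℕ.+ D ℕ.∸ 4)    ≡⟨ cong +_ (ℕP.m+n∸m≡n 4 D) ⟩
      + D                  ∎
      where open ≡-Reasoning

  n²≡[t²-4]y²⇒y≡0 : ∀ {t} → 2 < ∣ t ∣ → ∀ (n y : ℤ) → n * n ≡ (t * t - + 4) * (y * y) → y ≡ + 0
  n²≡[t²-4]y²⇒y≡0 {t} 2<∣t∣ n y n²≡[t²-4]y²
    with q , D , q²<D , D<[q+1]² , s²-4≡D ← s²-4-between-squares ∣ t ∣ 2<∣t∣ =
    ℤP.∣i∣≡0⇒i≡0 (n²≡Dy²⇒y≡0 {q} {D} q²<D D<[q+1]² ∣ y ∣ n (begin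
      n * n                        ≡⟨ n²≡[t²-4]y² ⟩
      (t * t - + 4) * (y * y)      ≡⟨ cong₂ (λ u v → (u - + 4) * v) (square-abs t) (square-abs y) ⟩
      (+ ∣ t ∣ * + ∣ t ∣ - + 4) * (+ ∣ y ∣ * + ∣ y ∣) ≡⟨ cong (_* (+ ∣ y ∣ * + ∣ y ∣)) s²-4≡D ⟩
      + D * (+ ∣ y ∣ * + ∣ y ∣)    ∎))
    where open ≡-Reasoning

module Forms where

  open import Data.Nat as ℕ using (s≤s; z≤n)
  import Data.Nat.Properties as ℕP
  open import Data.Integer using (ℤ; +_; _+_; _-_; _*_; -_; ∣_∣; 0ℤ; 1ℤ)
  import Data.Integer.Properties as ℤP
  open import Data.Integer.Tactic.RingSolver using (solve-∀)
  open import Data.Product using (_,_; proj₁; proj₂)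
  open import Data.Sum using ([_,_]′)
  open import Data.Empty using (⊥-elim)
  open import Function using (_∘_; id)
  open import Relation.Binary.PropositionalEquality
  open NonSquare using (n²≡[t²-4]y²⇒y≡0)

  det : Mat2 → ℤ
  det M = a M * d M - b M * c M

  transpose : Mat2 → Mat2
  transpose M = mat (a M) (c M) (b M) (d M)

  dot : Vec2 → Vec2 → ℤ
  dot (x₁ , y₁) (x₂ , y₂) = x₁ * x₂ + y₁ * y₂

  det-transpose : ∀ M → det (transpose M) ≡ det M
  det-transpose (mat a b c d) = identity a b c d
    where
    identity : ∀ a b c d → a * d - c * b ≡ a * d - b * c
    identity = solve-∀

  module _ (A : Mat2) where

    disc : ℤ
    disc = (a A + d A) * (a A + d A) - + 4

    -- Q A is invariant under the left action; for row vectors and the right action the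
    -- invariant form is this one, with Q A (x , y) = - form (y , - x).
    form : Vec2 → ℤ
    form (x , y) = b A * x * x + (d A - a A) * x * y - c A * y * y

    gram : Mat2
    gram = mat (+ 2 * b A) (d A - a A) (d A - a A) (- (+ 2 * c A))

    polar : Vec2 → Vec2 → ℤ
    polar u w = dot u (w · gram)

    frame : Vec2 → Mat2
    frame v = mat (proj₁ v) (proj₂ v) (proj₁ (v · A)) (proj₂ (v · A))

    det-frame : ∀ v → det (frame v) ≡ form v
    det-frame (v₁ , v₂) = identity (a A) (b A) (c A) (d A) v₁ v₂
      where
      identity : ∀ a b c d v₁ v₂ →
        v₁ * (v₁ * b + v₂ * d) - v₂ * (v₁ * a + v₂ * c) ≡ b * v₁ * v₁ + (d - a) * v₁ * v₂ - c * v₂ * v₂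
      identity = solve-∀

    x+[det-1]*y≡x : IsSL2 A → ∀ X Y → X + (det A - 1ℤ) * Y ≡ X
    x+[det-1]*y≡x det≡1 X Y = begin
      X + (det A - 1ℤ) * Y    ≡⟨ cong (λ δ → X + (δ - 1ℤ) * Y) det≡1 ⟩
      X + (1ℤ - 1ℤ) * Y       ≡⟨ ℤP.+-identityʳ X ⟩
      X                       ∎
      where open ≡-Reasoning

    form-·ι : IsSL2 A → ∀ v β → form (v · ι A β) ≡ normO A β * form v
    form-·ι det≡1 (v₁ , v₂) (x , y) =
      trans (identity (a A) (b A) (c A) (d A) v₁ v₂ x y) (x+[det-1]*y≡x det≡1 _ _)
      where
      identity : ∀ a b c d v₁ v₂ x y →
        let U₁ = v₁ * (x + y * a) + v₂ * (y * c)
            U₂ = v₁ * (y * b) + v₂ * (x + y * d)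
            F = b * v₁ * v₁ + (d - a) * v₁ * v₂ - c * v₂ * v₂ in
        b * U₁ * U₁ + (d - a) * U₁ * U₂ - c * U₂ * U₂ ≡
          (x * x + (a + d) * x * y + y * y) * F + (a * d - b * c - 1ℤ) * (y * y * F)
      identity = solve-∀

    det-gram : IsSL2 A → det gram ≡ - disc
    det-gram det≡1 = trans (identity (a A) (b A) (c A) (d A)) (x+[det-1]*y≡x det≡1 _ _)
      where
      identity : ∀ a b c d →
        + 2 * b * - (+ 2 * c) - (d - a) * (d - a) ≡ - ((a + d) * (a + d) - + 4) + (a * d - b * c - 1ℤ) * + 4
      identity = solve-∀

    polarization : ∀ u w → form (vsub u w) ≡ form u + form w - polar u w
    polarization (u₁ , u₂) (w₁ , w₂) = identity (a A) (b A) (c A) (d A) u₁ u₂ w₁ w₂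
      where
      identity : ∀ a b c d u₁ u₂ w₁ w₂ →
        b * (u₁ - w₁) * (u₁ - w₁) + (d - a) * (u₁ - w₁) * (u₂ - w₂) - c * (u₂ - w₂) * (u₂ - w₂) ≡
          (b * u₁ * u₁ + (d - a) * u₁ * u₂ - c * u₂ * u₂) + (b * w₁ * w₁ + (d - a) * w₁ * w₂ - c * w₂ * w₂)
          - (u₁ * (w₁ * (+ 2 * b) + w₂ * (d - a)) + u₂ * (w₁ * (d - a) + w₂ * - (+ 2 * c)))
      identity = solve-∀

    polar-·ι : ∀ m v β → polar (m · ι A β) v ≡ dot (polar m v , polar (m · A) v) β
    polar-·ι (m₁ , m₂) v (x , y) = identity (a A) (b A) (c A) (d A) m₁ m₂ x y _ _
      where
      identity : ∀ a b c d m₁ m₂ x y G₁ G₂ →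
        (m₁ * (x + y * a) + m₂ * (y * c)) * G₁ + (m₁ * (y * b) + m₂ * (x + y * d)) * G₂ ≡
          (m₁ * G₁ + m₂ * G₂) * x + ((m₁ * a + m₂ * c) * G₁ + (m₁ * b + m₂ * d) * G₂) * y
      identity = solve-∀

    polar-as-· : ∀ m v → (polar m v , polar (m · A) v) ≡ (v · gram) · transpose (frame m)
    polar-as-· (m₁ , m₂) v = cong₂ _,_ (identity m₁ m₂ _ _)
      (identity (m₁ * a A + m₂ * c A) (m₁ * b A + m₂ * d A) _ _)
      where
      identity : ∀ m₁ m₂ G₁ G₂ → m₁ * G₁ + m₂ * G₂ ≡ G₁ * m₁ + G₂ * m₂
      identity = solve-∀

    ·ι-vsub : ∀ v β β' → vsub (v · ι A β) (v · ι A β') ≡ vsub β β' · frame v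
    ·ι-vsub (v₁ , v₂) (x , y) (x' , y') =
      cong₂ _,_ (identity₁ (a A) (c A) v₁ v₂ x y x' y') (identity₂ (b A) (d A) v₁ v₂ x y x' y')
      where
      identity₁ : ∀ a c v₁ v₂ x y x' y' →
        (v₁ * (x + y * a) + v₂ * (y * c)) - (v₁ * (x' + y' * a) + v₂ * (y' * c)) ≡
          (x - x') * v₁ + (y - y') * (v₁ * a + v₂ * c)
      identity₁ = solve-∀
      identity₂ : ∀ b d v₁ v₂ x y x' y' →
        (v₁ * (y * b) + v₂ * (x + y * d)) - (v₁ * (y' * b) + v₂ * (x' + y' * d)) ≡
          (x - x') * v₂ + (y - y') * (v₁ * b + v₂ * d)
      identity₂ = solve-∀

    disc≢0 : Hyperbolic A → disc ≢ 0ℤ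
    disc≢0 hyp disc≡0 = ℕP.<⇒≢ (ℕP.≤-trans (s≤s (s≤s (s≤s (s≤s (s≤s z≤n))))) (ℕP.*-mono-≤ hyp hyp)) (sym ∣t∣²≡4)
      where
      t = a A + d A
      ∣t∣²≡4 : ∣ t ∣ ℕ.* ∣ t ∣ ≡ 4
      ∣t∣²≡4 = trans (sym (ℤP.abs-* t t)) (cong ∣_∣ (ℤP.i-j≡0⇒i≡j (t * t) (+ 4) disc≡0))

    completed-square : IsSL2 A → ∀ x y →
      (+ 2 * b A * x + (d A - a A) * y) * (+ 2 * b A * x + (d A - a A) * y) ≡
        disc * (y * y) + + 4 * b A * form (x , y)
    completed-square det≡1 x y = trans (identity (a A) (b A) (c A) (d A) x y) (x+[det-1]*y≡x det≡1 _ _)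
      where
      identity : ∀ a b c d x y →
        (+ 2 * b * x + (d - a) * y) * (+ 2 * b * x + (d - a) * y) ≡
          ((a + d) * (a + d) - + 4) * (y * y) + + 4 * b * (b * x * x + (d - a) * x * y - c * y * y)
          + (a * d - b * c - 1ℤ) * - (+ 4 * (y * y))
      identity = solve-∀

    b≢0 : IsSL2 A → Hyperbolic A → b A ≢ 0ℤ
    b≢0 det≡1 hyp b≡0 = ℕP.<⇒≱ hyp ∣a+d∣≤2
      where
      ad≡1 : a A * d A ≡ 1ℤ
      ad≡1 = begin
        a A * d A                  ≡⟨ ℤP.+-identityʳ (a A * d A) ⟨
        a A * d A - 0ℤ * c A       ≡⟨ cong (λ β → a A * d A - β * c A) b≡0 ⟨
        det A                      ≡⟨ det≡1 ⟩
        1ℤ                         ∎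
        where open ≡-Reasoning
      ∣a∣∣d∣≡1 : ∣ a A ∣ ℕ.* ∣ d A ∣ ≡ 1
      ∣a∣∣d∣≡1 = trans (sym (ℤP.abs-* (a A) (d A))) (cong ∣_∣ ad≡1)
      ∣a+d∣≤2 : ∣ a A + d A ∣ ℕ.≤ 2
      ∣a+d∣≤2 = begin
        ∣ a A + d A ∣         ≤⟨ ℤP.∣i+j∣≤∣i∣+∣j∣ (a A) (d A) ⟩
        ∣ a A ∣ ℕ.+ ∣ d A ∣   ≡⟨ cong₂ ℕ._+_ (ℕP.m*n≡1⇒m≡1 ∣ a A ∣ ∣ d A ∣ ∣a∣∣d∣≡1)
          (ℕP.m*n≡1⇒n≡1 ∣ a A ∣ ∣ d A ∣ ∣a∣∣d∣≡1) ⟩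
        2                     ∎
        where open ℕP.≤-Reasoning

    form-anisotropic : IsSL2 A → Hyperbolic A → ∀ v → form v ≡ 0ℤ → v ≡ (0ℤ , 0ℤ)
    form-anisotropic det≡1 hyp (x , y) form≡0 = cong₂ _,_ x≡0 y≡0
      where
      y≡0 : y ≡ 0ℤ
      y≡0 = n²≡[t²-4]y²⇒y≡0 {a A + d A} hyp n y (begin
        n * n                                      ≡⟨ completed-square det≡1 x y ⟩
        disc * (y * y) + + 4 * b A * form (x , y)  ≡⟨ cong (λ f → disc * (y * y) + + 4 * b A * f) form≡0 ⟩
        disc * (y * y) + + 4 * b A * 0ℤ            ≡⟨ cong (_+_ (disc * (y * y))) (ℤP.*-zeroʳ (+ 4 * b A)) ⟩
        disc * (y * y) + 0ℤ                        ≡⟨ ℤP.+-identityʳ _ ⟩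
        disc * (y * y)                             ∎)
        where
        open ≡-Reasoning
        n = + 2 * b A * x + (d A - a A) * y
      bx²≡0 : b A * (x * x) ≡ 0ℤ
      bx²≡0 = trans (sym (identity (b A) (d A - a A) (c A) x)) (subst (λ y → form (x , y) ≡ 0ℤ) y≡0 form≡0)
        where
        identity : ∀ b e c x → b * x * x + e * x * 0ℤ - c * 0ℤ * 0ℤ ≡ b * (x * x)
        identity = solve-∀
      x≡0 : x ≡ 0ℤ
      x≡0 = [ ⊥-elim ∘ b≢0 det≡1 hyp , [ id , id ]′ ∘ ℤP.i*j≡0⇒i≡0∨j≡0 x ]′ (ℤP.i*j≡0⇒i≡0∨j≡0 (b A) bx²≡0)

module Residues where

  open import Data.Nat as ℕ using (zero; suc; _<_)
  import Data.Nat.Properties as ℕP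
  open import Data.Nat.Divisibility using (_∣_; divides; ∣⇒≤)
  open import Data.Nat.Coprimality using (Coprime; coprime-divisor)
  open import Data.Nat.Primality using (prime⇒irreducible; prime[2])
  open import Data.Integer using (+_; _-_; ∣_∣)
  import Data.Integer.Properties as ℤP
  open import Data.Fin using (Fin; toℕ)
  open import Data.Fin.Properties using (toℕ<n; toℕ-injective)
  open import Data.Product using (_,_)
  open import Data.Sum using (inj₁; inj₂)
  open import Data.Empty using (⊥-elim)
  open import Relation.Nullary using (¬_)
  open import Relation.Binary.PropositionalEquality

  ∣∧<⇒≡0 : ∀ {M n} → M ∣ n → n < M → n ≡ 0
  ∣∧<⇒≡0 {n = zero} _ _ = refl
  ∣∧<⇒≡0 {n = suc _} M∣n n<M = ⊥-elim (ℕP.<⇒≱ n<M (∣⇒≤ M∣n))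

  toℕ-injective-mod : ∀ {M} (i j : Fin M) → M ∣ ∣ + toℕ i - + toℕ j ∣ → i ≡ j
  toℕ-injective-mod {M} i j M∣i-j =
    toℕ-injective (ℤP.+-injective (ℤP.i-j≡0⇒i≡j _ _ (ℤP.∣i∣≡0⇒i≡0 (∣∧<⇒≡0 M∣i-j ∣i-j∣<M))))
    where
    ∣i-j∣<M : ∣ + toℕ i - + toℕ j ∣ < M
    ∣i-j∣<M = subst (_< M) (cong ∣_∣ (sym (ℤP.m-n≡m⊖n (toℕ i) (toℕ j))))
      (ℕP.≤-<-trans (ℤP.∣m⊝n∣≤m⊔n (toℕ i) (toℕ j)) (ℕP.⊔-lub (toℕ<n i) (toℕ<n j)))

  ∣-2*-odd : ∀ {N k} → ¬ 2 ∣ N → 2 ∣ k → N ∣ k → 2 ℕ.* N ∣ k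
  ∣-2*-odd {N} 2∤N 2∣k (divides q k≡qN) with coprime-divisor coprime-2-N
    (subst (2 ∣_) (trans k≡qN (ℕP.*-comm q N)) 2∣k)
    where
    coprime-2-N : Coprime 2 N
    coprime-2-N (d∣2 , d∣N) with prime⇒irreducible prime[2] d∣2
    ... | inj₁ d≡1 = d≡1
    ... | inj₂ refl = ⊥-elim (2∤N d∣N)
  ... | divides r q≡r2 = divides r (trans k≡qN (trans (cong (ℕ._* N) q≡r2) (ℕP.*-assoc r 2 N)))

module Modular (p : ℕ) (p-prime : Prime p) where

  open import Data.Nat as ℕ using (zero; suc; _<_)
  import Data.Nat.Divisibility as ℕ
  open import Data.Nat.Coprimality using (coprime-Bézout; prime⇒coprime)
  open import Data.Nat.GCD using (module Bézout)
  open import Data.Nat.Primality using (prime⇒nonZero; euclidsLemma; prime⇒irreducible; prime[2]; ¬prime[1])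
  open import Data.Integer as ℤ using (ℤ; +_; _+_; _-_; _*_; -_; ∣_∣; 0ℤ; 1ℤ)
  import Data.Integer.Properties as ℤP
  import Data.Integer.DivMod as ℤ
  open import Data.Integer.Divisibility.Signed
  open import Data.Integer.Tactic.RingSolver using (solve-∀)
  open import Data.Fin using (Fin; toℕ; fromℕ<)
  open import Data.Fin.Properties using (toℕ-fromℕ<; toℕ<n)
  open import Data.Product using (∃; _×_; _,_)
  open import Data.Sum using (_⊎_; inj₁; inj₂)
  open import Data.Empty using (⊥-elim)
  open import Relation.Nullary using (¬_; Dec)
  open import Relation.Nullary.Decidable using (_×-dec_)
  open import Relation.Binary.PropositionalEquality
  open import Function using (_∘′_)
  open Forms using (det; dot)

  private
    instance
      p≢0 : ℕ.NonZero p
      p≢0 = prime⇒nonZero p-prime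

  infix 4 p∣_
  p∣_ : ℤ → Set
  p∣ x = + p ∣ x

  ∣-by : ∀ {x y} → x ≡ y → p∣ y → p∣ x
  ∣-by x≡y = subst p∣_ (sym x≡y)

  ∣m*n⇒∣m⊎∣n : ∀ {x y} → p∣ x * y → p∣ x ⊎ p∣ y
  ∣m*n⇒∣m⊎∣n {x} {y} p∣xy with euclidsLemma ∣ x ∣ ∣ y ∣ p-prime (subst (p ℕ.∣_) (ℤP.abs-* x y) (∣⇒∣ᵤ p∣xy))
  ... | inj₁ p∣x = inj₁ (∣ᵤ⇒∣ p∣x)
  ... | inj₂ p∣y = inj₂ (∣ᵤ⇒∣ p∣y)

  ∣-*-cancelˡ : ∀ {x y} → ¬ (p∣ x) → p∣ x * y → p∣ y
  ∣-*-cancelˡ p∤x p∣xy with ∣m*n⇒∣m⊎∣n p∣xy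
  ... | inj₁ p∣x = ⊥-elim (p∤x p∣x)
  ... | inj₂ p∣y = p∣y

  ∣-small⇒≡0 : ∀ {z} → p∣ z → ∣ z ∣ < p → z ≡ 0ℤ
  ∣-small⇒≡0 p∣z ∣z∣<p = ℤP.∣i∣≡0⇒i≡0 (Residues.∣∧<⇒≡0 (∣⇒∣ᵤ p∣z) ∣z∣<p)

  p∤2 : ¬ (2 ℕ.∣ p) → ¬ (p∣ + 2)
  p∤2 2∤p p∣2 with prime⇒irreducible prime[2] (∣⇒∣ᵤ p∣2)
  ... | inj₁ refl = ¬prime[1] p-prime
  ... | inj₂ refl = 2∤p ℕ.∣-refl

  ∃-residue : ∀ z → ∃ λ (r : Fin p) → p∣ + toℕ r - z
  ∃-residue z = fromℕ< (ℤ.n%ℕd<d z p) , ∣-by r-z≡-[z/p]p (divides (- (z ℤ./ℕ p)) refl)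
    where
    r-z≡-[z/p]p : + toℕ (fromℕ< (ℤ.n%ℕd<d z p)) - z ≡ - (z ℤ./ℕ p) * + p
    r-z≡-[z/p]p = begin
      + toℕ (fromℕ< (ℤ.n%ℕd<d z p)) - z            ≡⟨ cong (λ r → + r - z) (toℕ-fromℕ< (ℤ.n%ℕd<d z p)) ⟩
      + (z ℤ.%ℕ p) - z                             ≡⟨ cong (_-_ (+ (z ℤ.%ℕ p))) (ℤ.a≡a%ℕn+[a/ℕn]*n z p) ⟩
      + (z ℤ.%ℕ p) - (+ (z ℤ.%ℕ p) + (z ℤ./ℕ p) * + p) ≡⟨ identity (+ (z ℤ.%ℕ p)) (z ℤ./ℕ p) (+ p) ⟩
      - (z ℤ./ℕ p) * + p                           ∎
      where
      open ≡-Reasoning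
      identity : ∀ r q p → r - (r + q * p) ≡ - q * p
      identity = solve-∀

  private
    ℤ-Bézout : ∀ i j k l → 1 ℕ.+ i ℕ.* j ≡ k ℕ.* l → 1ℤ + + i * + j ≡ + k * + l
    ℤ-Bézout i j k l eq = begin
      1ℤ + + i * + j    ≡⟨ cong (_+_ 1ℤ) (ℤP.pos-* i j) ⟨
      + (1 ℕ.+ i ℕ.* j) ≡⟨ cong +_ eq ⟩
      + (k ℕ.* l)       ≡⟨ ℤP.pos-* k l ⟩
      + k * + l         ∎
      where open ≡-Reasoning

  ∃-inverse-ℕ : ∀ {n} .{{_ : ℕ.NonZero n}} → n < p → ∃ λ w → p∣ w * + n - 1ℤ
  ∃-inverse-ℕ {n} n<p with coprime-Bézout (prime⇒coprime p-prime n<p)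
  ... | Bézout.+- x y 1+yn≡xp = - + y , divides (- + x) (begin
    - + y * + n - 1ℤ       ≡⟨ identity (+ y) (+ n) ⟩
    - (1ℤ + + y * + n)     ≡⟨ cong -_ (ℤ-Bézout y n x p 1+yn≡xp) ⟩
    - (+ x * + p)          ≡⟨ ℤP.neg-distribˡ-* (+ x) (+ p) ⟩
    - + x * + p            ∎)
    where
    open ≡-Reasoning
    identity : ∀ y n → - y * n - 1ℤ ≡ - (1ℤ + y * n)
    identity = solve-∀
  ... | Bézout.-+ x y 1+xp≡yn = + y , divides (+ x) (begin
    + y * + n - 1ℤ         ≡⟨ cong (_- 1ℤ) (ℤ-Bézout x p y n 1+xp≡yn) ⟨
    1ℤ + + x * + p - 1ℤ    ≡⟨ identity (+ x * + p) ⟩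
    + x * + p              ∎)
    where
    open ≡-Reasoning
    identity : ∀ xp → 1ℤ + xp - 1ℤ ≡ xp
    identity = solve-∀

  ∃-inverse : ∀ z → ¬ p∣ z → ∃ λ w → p∣ w * z - 1ℤ
  ∃-inverse z p∤z with r , p∣r-z ← ∃-residue z with toℕ r in r≡n
  ... | zero = ⊥-elim (p∤z (∣-by (identity z) (∣m⇒∣-m p∣r-z)))
    where
    identity : ∀ z → z ≡ - (+ 0 - z)
    identity = solve-∀
  ... | n@(suc _) with w , p∣wn-1 ← ∃-inverse-ℕ (subst (_< p) r≡n (toℕ<n r)) =
    w , ∣-by (identity w (+ n) z) (∣m∣n⇒∣m-n p∣wn-1 (∣n⇒∣m*n w p∣r-z))
    where
    identity : ∀ w n z → w * z - 1ℤ ≡ (w * n - 1ℤ) - w * (n - z)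
    identity = solve-∀

  infix 4 p∣?_
  p∣?_ : ∀ x → Dec (p∣ x)
  p∣? x = + p ∣? x

  p∣square⇒p∣ : ∀ {x} → p∣ x * x → p∣ x
  p∣square⇒p∣ p∣x² with ∣m*n⇒∣m⊎∣n p∣x²
  ... | inj₁ p∣x = p∣x
  ... | inj₂ p∣x = p∣x

  Null : Vec2 → Set
  Null (x , y) = p∣ x × p∣ y

  infix 4 _≋_
  _≋_ : Vec2 → Vec2 → Set
  u ≋ w = Null (vsub u w)

  infix 4 _≋?_
  _≋?_ : ∀ u w → Dec (u ≋ w)
  (u₁ , u₂) ≋? (w₁ , w₂) = (+ p ∣? u₁ - w₁) ×-dec (+ p ∣? u₂ - w₂)

  private
    ∣-sym-diff : ∀ {x y} → p∣ x - y → p∣ y - x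
    ∣-sym-diff {x} {y} = ∣-by (identity x y) ∘′ ∣m⇒∣-m
      where
      identity : ∀ x y → y - x ≡ - (x - y)
      identity = solve-∀

    ∣-trans-diff : ∀ {x y z} → p∣ x - y → p∣ y - z → p∣ x - z
    ∣-trans-diff {x} {y} {z} p∣x-y p∣y-z = ∣-by (identity x y z) (∣m∣n⇒∣m+n p∣x-y p∣y-z)
      where
      identity : ∀ x y z → x - z ≡ (x - y) + (y - z)
      identity = solve-∀

  ≋-sym : ∀ {u w} → u ≋ w → w ≋ u
  ≋-sym {u₁ , u₂} {w₁ , w₂} (p∣u₁-w₁ , p∣u₂-w₂) = ∣-sym-diff {u₁} p∣u₁-w₁ , ∣-sym-diff {u₂} p∣u₂-w₂

  ≋-trans : ∀ {u v w} → u ≋ v → v ≋ w → u ≋ w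
  ≋-trans {u₁ , u₂} {v₁ , v₂} {w₁ , w₂} (p∣u₁-v₁ , p∣u₂-v₂) (p∣v₁-w₁ , p∣v₂-w₂) =
    ∣-trans-diff {u₁} {v₁} p∣u₁-v₁ p∣v₁-w₁ , ∣-trans-diff {u₂} {v₂} p∣u₂-v₂ p∣v₂-w₂

  Null-dot : ∀ {v} w → Null v → p∣ dot v w
  Null-dot (w₁ , w₂) (p∣v₁ , p∣v₂) = ∣m∣n⇒∣m+n (∣m⇒∣m*n w₁ p∣v₁) (∣m⇒∣m*n w₂ p∣v₂)

  -- Cramer's rule: adj M applied to v · M gives (det M) v.
  Null-·-cancel : ∀ v M → ¬ p∣ det M → Null (v · M) → Null v
  Null-·-cancel (v₁ , v₂) (mat a b c d) p∤det (p∣u₁ , p∣u₂) =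
    ∣-*-cancelˡ p∤det (∣-by (identity₁ a b c d v₁ v₂) (∣m∣n⇒∣m-n (∣n⇒∣m*n d p∣u₁) (∣n⇒∣m*n c p∣u₂))) ,
    ∣-*-cancelˡ p∤det (∣-by (identity₂ a b c d v₁ v₂) (∣m∣n⇒∣m-n (∣n⇒∣m*n a p∣u₂) (∣n⇒∣m*n b p∣u₁)))
    where
    identity₁ : ∀ a b c d v₁ v₂ → (a * d - b * c) * v₁ ≡ d * (v₁ * a + v₂ * c) - c * (v₁ * b + v₂ * d)
    identity₁ = solve-∀
    identity₂ : ∀ a b c d v₁ v₂ → (a * d - b * c) * v₂ ≡ a * (v₁ * b + v₂ * d) - b * (v₁ * a + v₂ * c)
    identity₂ = solve-∀

  quadratic-three-roots : ∀ α β γ {y₁ y₂ y₃} →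
    p∣ α * (y₁ * y₁) + β * y₁ + γ → p∣ α * (y₂ * y₂) + β * y₂ + γ → p∣ α * (y₃ * y₃) + β * y₃ + γ →
    ¬ p∣ y₁ - y₂ → ¬ p∣ y₁ - y₃ → ¬ p∣ y₂ - y₃ → p∣ α × p∣ β × p∣ γ
  quadratic-three-roots α β γ {y₁} {y₂} {y₃} f₁ f₂ f₃ y₁≢y₂ y₁≢y₃ y₂≢y₃ = p∣α , p∣β , p∣γ
    where
    divided-difference : ∀ {y y'} → p∣ α * (y * y) + β * y + γ → p∣ α * (y' * y') + β * y' + γ → ¬ p∣ y - y' →
            p∣ α * (y + y') + β
    divided-difference {y} {y'} f f' y≢y' = ∣-*-cancelˡ y≢y' (∣-by (identity α β γ y y') (∣m∣n⇒∣m-n f f'))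
      where
      identity : ∀ α β γ y y' → (y - y') * (α * (y + y') + β) ≡ (α * (y * y) + β * y + γ) -
        (α * (y' * y') + β * y' + γ)
      identity = solve-∀
    p∣α : p∣ α
    p∣α = ∣-*-cancelˡ y₂≢y₃ (∣-by (identity α β y₁ y₂ y₃)
      (∣m∣n⇒∣m-n (divided-difference f₁ f₂ y₁≢y₂) (divided-difference f₁ f₃ y₁≢y₃)))
      where
      identity : ∀ α β y₁ y₂ y₃ → (y₂ - y₃) * α ≡ (α * (y₁ + y₂) + β) - (α * (y₁ + y₃) + β)
      identity = solve-∀
    p∣β : p∣ β
    p∣β = ∣-by (identity α β y₁ y₂) (∣m∣n⇒∣m-n (divided-difference f₁ f₂ y₁≢y₂) (∣n⇒∣m*n (y₁ + y₂) p∣α))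
      where
      identity : ∀ α β y₁ y₂ → β ≡ (α * (y₁ + y₂) + β) - (y₁ + y₂) * α
      identity = solve-∀
    p∣γ : p∣ γ
    p∣γ = ∣-by (identity α β γ y₁) (∣m∣n⇒∣m-n (∣m∣n⇒∣m-n f₁ (∣n⇒∣m*n (y₁ * y₁) p∣α)) (∣n⇒∣m*n y₁ p∣β))
      where
      identity : ∀ α β γ y₁ → γ ≡ (α * (y₁ * y₁) + β * y₁ + γ) - (y₁ * y₁) * α - y₁ * β
      identity = solve-∀

module ModularForms (A : Mat2) (det≡1 : IsSL2 A) (p : ℕ) (p-prime : Prime p) where

  open import Data.Integer using (ℤ; +_; _+_; _-_; _*_; -_; 1ℤ)
  import Data.Integer.Properties as ℤP
  open import Data.Integer.Divisibility.Signed
  open import Data.Integer.Tactic.RingSolver using (solve-∀)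
  open import Data.Nat using (suc)
  open import Data.Fin using (Fin; zero; suc; toℕ)
  open import Data.Product using (∃; _,_; proj₁; proj₂; swap)
  open import Data.Sum using (inj₁; inj₂; [_,_]′)
  open import Data.Empty using (⊥; ⊥-elim)
  open import Relation.Nullary using (¬_; Dec; yes; no)
  open import Relation.Binary.PropositionalEquality
  open import Function using (_∘_)
  open Forms
  open Modular p p-prime

  OnTorus : Vec2 → Set
  OnTorus β = p∣ normO A β - 1ℤ

  form-cong : ∀ {u w} → u ≋ w → p∣ form A u - form A w
  form-cong {u₁ , u₂} {w₁ , w₂} u≋w =
    ∣-by (identity (a A) (b A) (c A) (d A) u₁ u₂ w₁ w₂) (Null-dot (_ , _) u≋w)
    where
    identity : ∀ a b c d u₁ u₂ w₁ w₂ →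
      (b * u₁ * u₁ + (d - a) * u₁ * u₂ - c * u₂ * u₂) - (b * w₁ * w₁ + (d - a) * w₁ * w₂ - c * w₂ * w₂) ≡
        (u₁ - w₁) * (b * (u₁ + w₁) + (d - a) * u₂) + (u₂ - w₂) * ((d - a) * w₁ - c * (u₂ + w₂))
    identity = solve-∀

  form-·ι-cong : ∀ v β → OnTorus β → p∣ form A (v · ι A β) - form A v
  form-·ι-cong v β β∈T =
    ∣-by (trans (cong (_- form A v) (form-·ι A det≡1 v β)) (identity (normO A β) (form A v)))
      (∣m⇒∣m*n (form A v) β∈T)
    where
    identity : ∀ N F → N * F - F ≡ (N - 1ℤ) * F
    identity = solve-∀

  ·ι-cancel : ∀ {v} β β' → ¬ p∣ form A v → v · ι A β ≋ v · ι A β' → β ≋ β'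
  ·ι-cancel {v} β β' p∤form vβ≋vβ' =
    Null-·-cancel (vsub β β') (frame A v) (subst (¬_ ∘ p∣_) (sym (det-frame A v)) p∤form)
      (subst Null (·ι-vsub A v β β') vβ≋vβ')

  line-normal : Vec2 → Vec2 → Vec2
  line-normal m v = (polar A m v , polar A (m · A) v)

  line-normal-nondegenerate : ∀ {m v} → ¬ p∣ disc A → ¬ p∣ form A m → Null (line-normal m v) → Null v
  line-normal-nondegenerate {m} {v} p∤disc p∤form-m null =
    Null-·-cancel v (gram A) p∤det-gram
      (Null-·-cancel (v · gram A) (transpose (frame A m)) p∤det-frameᵀ (subst Null (polar-as-· A m v) null))
    where
    p∤det-frameᵀ : ¬ p∣ det (transpose (frame A m))
    p∤det-frameᵀ = subst (¬_ ∘ p∣_) (sym (trans (det-transpose (frame A m)) (det-frame A m))) p∤form-m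
    p∤det-gram : ¬ p∣ det (gram A)
    p∤det-gram p∣det =
      p∤disc (∣-by (sym (ℤP.neg-involutive (disc A))) (∣m⇒∣-m (subst p∣_ (det-gram A det≡1) p∣det)))

  -- form A (m β₃ - v) ≡ form A (n β₄) ≡ form A n and form A (m β₃) ≡ form A m; by polarization
  -- what remains is linear in β₃.
  line-through : ∀ m n v {β₃ β₄} → OnTorus β₃ → OnTorus β₄ → vsub (m · ι A β₃) v ≋ n · ι A β₄ →
    p∣ dot (line-normal m v) β₃ - (form A m + form A v - form A n)
  line-through m n v {β₃} {β₄} β₃∈T β₄∈T U-v≋Z =
    ∣-by chain (∣m∣n⇒∣m-n (∣m∣n⇒∣m-n (form-·ι-cong m β₃ β₃∈T) (form-cong {vsub U v} {Z} U-v≋Z))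
      (form-·ι-cong n β₄ β₄∈T))
    where
    open ≡-Reasoning
    U = m · ι A β₃
    Z = n · ι A β₄
    identity : ∀ P FU Fv Fm Fn FZ →
      P - (Fm + Fv - Fn) ≡ (FU - Fm) - ((FU + Fv - P) - FZ) - (FZ - Fn)
    identity = solve-∀
    chain : dot (line-normal m v) β₃ - (form A m + form A v - form A n) ≡
      (form A U - form A m) - (form A (vsub U v) - form A Z) - (form A Z - form A n)
    chain = begin
      dot (line-normal m v) β₃ - (form A m + form A v - form A n)
        ≡⟨ cong (_- (form A m + form A v - form A n)) (polar-·ι A m v β₃) ⟨
      polar A U v - (form A m + form A v - form A n)
        ≡⟨ identity (polar A U v) (form A U) (form A v) (form A m) (form A n) (form A Z) ⟩
      (form A U - form A m) - ((form A U + form A v - polar A U v) - form A Z) - (form A Z - form A n)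
        ≡⟨ cong (λ F → (form A U - form A m) - (F - form A Z) - (form A Z - form A n)) (polarization A U v) ⟨
      (form A U - form A m) - (form A (vsub U v) - form A Z) - (form A Z - form A n) ∎

  module Torus (p∤2 : ¬ p∣ + 2) (p∤disc : ¬ p∣ disc A) where

    private
      t : ℤ
      t = a A + d A

      trace-disc : ∀ S → disc A ≡ (+ 2 * S + t) * (+ 2 * S + t) - + 4 * normO A (S , 1ℤ)
      trace-disc S = identity (a A) (d A) S
        where
        identity : ∀ a d S → (a + d) * (a + d) - + 4 ≡
          (+ 2 * S + (a + d)) * (+ 2 * S + (a + d)) - + 4 * (S * S + (a + d) * S * 1ℤ + 1ℤ * 1ℤ)
        identity = solve-∀

    -- S + α has trace 2S + t and norm S² + t S + 1, and disc = trace² - 4 norm.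
    trace-norm-not-both-zero : ∀ S → p∣ + 2 * S + t → p∣ normO A (S , 1ℤ) → ⊥
    trace-norm-not-both-zero S p∣τ p∣σ = p∤disc
      (∣-by (trace-disc S) (∣m∣n⇒∣m-n (∣n⇒∣m*n (+ 2 * S + t) p∣τ) (∣n⇒∣m*n (+ 4) p∣σ)))

    -- Stereographic projection of the conic x² + t x y + y² = 1 from (-1 , 0): a point is sent to
    -- the line joining it to (-1 , 0), the line x + 1 = s y giving suc s and the line y = 0 giving
    -- zero; (-1 , 0) itself is sent to its tangent.
    data Slope (x y : ℤ) : Fin (suc p) → Set where
      secant     : ∀ s → ¬ p∣ y → p∣ + toℕ s * y - (1ℤ + x) → Slope x y (suc s)
      tangent    : ∀ s → p∣ y → ¬ p∣ x - 1ℤ → p∣ + 2 * + toℕ s + t → Slope x y (suc s)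
      horizontal : p∣ y → p∣ x - 1ℤ → Slope x y zero

    slope : ∀ x y → ∃ (Slope x y)
    slope x y with p∣? y
    ... | no p∤y with w , p∣wy-1 ← ∃-inverse y p∤y with s , p∣s-[1+x]w ← ∃-residue ((1ℤ + x) * w) =
      suc s , secant s p∤y
        (∣-by (identity (+ toℕ s) x y w) (∣m∣n⇒∣m+n (∣m⇒∣m*n y p∣s-[1+x]w) (∣n⇒∣m*n (1ℤ + x) p∣wy-1)))
      where
      identity : ∀ S x y w → S * y - (1ℤ + x) ≡ (S - (1ℤ + x) * w) * y + (1ℤ + x) * (w * y - 1ℤ)
      identity = solve-∀
    ... | yes p∣y with p∣? x - 1ℤ
    ...   | yes p∣x-1 = zero , horizontal p∣y p∣x-1
    ...   | no p∤x-1 with w , p∣w2-1 ← ∃-inverse (+ 2) p∤2 with s , p∣s+tw ← ∃-residue (- t * w) =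
      suc s , tangent s p∣y p∤x-1
        (∣-by (identity (+ toℕ s) t w) (∣m∣n⇒∣m-n (∣n⇒∣m*n (+ 2) p∣s+tw) (∣n⇒∣m*n t p∣w2-1)))
      where
      identity : ∀ S t w → + 2 * S + t ≡ + 2 * (S - - t * w) - t * (w * + 2 - 1ℤ)
      identity = solve-∀

    secant-relation : ∀ x y S → OnTorus (x , y) → ¬ p∣ y → p∣ S * y - (1ℤ + x) →
      p∣ y * normO A (S , 1ℤ) - (+ 2 * S + t)
    secant-relation x y S on-T p∤y on-line = ∣-*-cancelˡ p∤y
      (∣-by (identity (a A) (d A) S x y) (∣m∣n⇒∣m+n on-T (∣m⇒∣m*n (x + (S * y - 1ℤ) + t * y) on-line)))
      where
      identity : ∀ a d S x y →
        y * (y * (S * S + (a + d) * S * 1ℤ + 1ℤ * 1ℤ) - (+ 2 * S + (a + d))) ≡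
          (x * x + (a + d) * x * y + y * y - 1ℤ) + (S * y - (1ℤ + x)) * (x + (S * y - 1ℤ) + (a + d) * y)
      identity = solve-∀

    secant-not-tangent : ∀ x y S → OnTorus (x , y) → ¬ p∣ y → p∣ S * y - (1ℤ + x) → ¬ p∣ + 2 * S + t
    secant-not-tangent x y S on-T p∤y on-line p∣τ = trace-norm-not-both-zero S p∣τ
      (∣-*-cancelˡ p∤y (∣-by (identity y (normO A (S , 1ℤ)) (+ 2 * S + t))
        (∣m∣n⇒∣m+n (secant-relation x y S on-T p∤y on-line) p∣τ)))
      where
      identity : ∀ y σ τ → y * σ ≡ (y * σ - τ) + τ
      identity = solve-∀

    secants-agree : ∀ x y x' y' S → OnTorus (x , y) → OnTorus (x' , y') → ¬ p∣ y → ¬ p∣ y' →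
      p∣ S * y - (1ℤ + x) → p∣ S * y' - (1ℤ + x') → (x , y) ≋ (x' , y')
    secants-agree x y x' y' S on-T on-T' p∤y p∤y' on-line on-line'
      with ∣m*n⇒∣m⊎∣n (∣-by (identity₁ σ τ y y')
             (∣m∣n⇒∣m-n (secant-relation x y S on-T p∤y on-line) (secant-relation x' y' S on-T' p∤y' on-line')))
      where
      σ = normO A (S , 1ℤ)
      τ = + 2 * S + t
      identity₁ : ∀ σ τ y y' → (y - y') * σ ≡ (y * σ - τ) - (y' * σ - τ)
      identity₁ = solve-∀
    ... | inj₁ p∣y-y' = ∣-by (identity₂ S x y x' y')
        (∣m∣n⇒∣m+n (∣m∣n⇒∣m-n (∣n⇒∣m*n S p∣y-y') on-line) on-line') , p∣y-y'
      where
      identity₂ : ∀ S x y x' y' → x - x' ≡ S * (y - y') - (S * y - (1ℤ + x)) + (S * y' - (1ℤ + x'))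
      identity₂ = solve-∀
    ... | inj₂ p∣σ = ⊥-elim (secant-not-tangent x y S on-T p∤y on-line
      (∣-by (identity₃ (normO A (S , 1ℤ)) (+ 2 * S + t) y)
        (∣m∣n⇒∣m-n (∣n⇒∣m*n y p∣σ) (secant-relation x y S on-T p∤y on-line))))
      where
      identity₃ : ∀ σ τ y → τ ≡ y * σ - (y * σ - τ)
      identity₃ = solve-∀

    tangent-point : ∀ x y → OnTorus (x , y) → p∣ y → ¬ p∣ x - 1ℤ → p∣ x + 1ℤ
    tangent-point x y on-T p∣y p∤x-1 =
      ∣-*-cancelˡ p∤x-1 (∣-by (identity (a A) (d A) x y) (∣m∣n⇒∣m-n on-T (∣m⇒∣m*n (t * x + y) p∣y)))
      where
      identity : ∀ a d x y → (x - 1ℤ) * (x + 1ℤ) ≡ (x * x + (a + d) * x * y + y * y - 1ℤ) - y *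
        ((a + d) * x + y)
      identity = solve-∀

    slope-injective : ∀ {x y x' y' κ} → OnTorus (x , y) → OnTorus (x' , y') →
      Slope x y κ → Slope x' y' κ → (x , y) ≋ (x' , y')
    slope-injective {x} {y} {x'} {y'} on-T on-T' (secant s p∤y on-line) (secant .s p∤y' on-line') =
      secants-agree x y x' y' (+ toℕ s) on-T on-T' p∤y p∤y' on-line on-line'
    slope-injective {x} {y} on-T _ (secant s p∤y on-line) (tangent .s _ _ p∣τ) =
      ⊥-elim (secant-not-tangent x y (+ toℕ s) on-T p∤y on-line p∣τ)
    slope-injective {x' = x'} {y'} _ on-T' (tangent s _ _ p∣τ) (secant .s p∤y' on-line') =
      ⊥-elim (secant-not-tangent x' y' (+ toℕ s) on-T' p∤y' on-line' p∣τ)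
    slope-injective {x} {y} {x'} {y'} on-T on-T' (tangent _ p∣y p∤x-1 _) (tangent _ p∣y' p∤x'-1 _) =
      ∣-by (identity x x') (∣m∣n⇒∣m-n (tangent-point x y on-T p∣y p∤x-1) (tangent-point x' y' on-T' p∣y' p∤x'-1)) ,
      ∣m∣n⇒∣m-n p∣y p∣y'
      where
      identity : ∀ x x' → x - x' ≡ (x + 1ℤ) - (x' + 1ℤ)
      identity = solve-∀
    slope-injective {x} {x' = x'} _ _ (horizontal p∣y p∣x-1) (horizontal p∣y' p∣x'-1) =
      ∣-by (identity x x') (∣m∣n⇒∣m-n p∣x-1 p∣x'-1) , ∣m∣n⇒∣m-n p∣y p∣y'
      where
      identity : ∀ x x' → x - x' ≡ (x - 1ℤ) - (x' - 1ℤ)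
      identity = solve-∀

    private
      -- Substituting P x = K - Q y into x² + t x y + y² = 1.
      on-parabola : ∀ P Q K x y → OnTorus (x , y) → p∣ P * x + Q * y - K →
        p∣ (Q * Q - t * P * Q + P * P) * (y * y) + (t * K * P - + 2 * K * Q) * y + (K * K - P * P)
      on-parabola P Q K x y on-T on-line =
        ∣-by (identity t P Q K x y)
          (∣m∣n⇒∣m-n (∣n⇒∣m*n (P * P) on-T) (∣m⇒∣m*n (P * x + (K - Q * y) + t * P * y) on-line))
        where
        identity : ∀ t P Q K x y →
          (Q * Q - t * P * Q + P * P) * (y * y) + (t * K * P - + 2 * K * Q) * y + (K * K - P * P) ≡
            P * P * (x * x + t * x * y + y * y - 1ℤ) - (P * x + Q * y - K) * (P * x + (K - Q * y) + t * P * y)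
        identity = solve-∀

      factor-β : ∀ t K P Q → t * K * P - + 2 * K * Q ≡ K * (t * P - + 2 * Q)
      factor-β = solve-∀

      square-from-γ : ∀ P K → P * P ≡ K * K - (K * K - P * P)
      square-from-γ = solve-∀

      disc-from-α : ∀ t P Q → (t * t - + 4) * (P * P) ≡ (t * P - + 2 * Q) * (t * P - + 2 * Q) - + 4 *
        (Q * Q - t * P * Q + P * P)
      disc-from-α = solve-∀

      y-differ : ∀ P Q K x y x' y' → ¬ p∣ P → p∣ P * x + Q * y - K → p∣ P * x' + Q * y' - K →
        ¬ (x , y) ≋ (x' , y') → ¬ p∣ y - y'
      y-differ P Q K x y x' y' p∤P on-line on-line' β≉β' p∣y-y' = β≉β' (p∣x-x' , p∣y-y')
        where
        identity : ∀ P Q K x y x' y' → P * (x - x') ≡ (P * x + Q * y - K) - (P * x' + Q * y' - K) - Q * (y - y')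
        identity = solve-∀
        p∣x-x' = ∣-*-cancelˡ p∤P (∣-by (identity P Q K x y x' y')
          (∣m∣n⇒∣m-n (∣m∣n⇒∣m-n on-line on-line') (∣n⇒∣m*n Q p∣y-y')))

      line-torus-no-three : ∀ {P Q K x₁ y₁ x₂ y₂ x₃ y₃} → ¬ p∣ P →
        OnTorus (x₁ , y₁) → OnTorus (x₂ , y₂) → OnTorus (x₃ , y₃) →
        p∣ P * x₁ + Q * y₁ - K → p∣ P * x₂ + Q * y₂ - K → p∣ P * x₃ + Q * y₃ - K →
        ¬ (x₁ , y₁) ≋ (x₂ , y₂) → ¬ (x₁ , y₁) ≋ (x₃ , y₃) → ¬ (x₂ , y₂) ≋ (x₃ , y₃) → ⊥
      line-torus-no-three {P} {Q} {K} {x₁} {y₁} {x₂} {y₂} {x₃} {y₃} p∤P T₁ T₂ T₃ L₁ L₂ L₃ β₁≉β₂ β₁≉β₃ β₂≉β₃ =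
        [ K≢0 , [ p∤disc , p∤P ∘ p∣square⇒p∣ ]′ ∘ ∣m*n⇒∣m⊎∣n ∘ disc-P² ]′
          (∣m*n⇒∣m⊎∣n (∣-by (sym (factor-β t K P Q)) p∣β))
        where
        coefficients = quadratic-three-roots (Q * Q - t * P * Q + P * P) (t * K * P - + 2 * K * Q)
          (K * K - P * P)
          (on-parabola P Q K x₁ y₁ T₁ L₁) (on-parabola P Q K x₂ y₂ T₂ L₂) (on-parabola P Q K x₃ y₃ T₃ L₃)
          (y-differ P Q K x₁ y₁ x₂ y₂ p∤P L₁ L₂ β₁≉β₂) (y-differ P Q K x₁ y₁ x₃ y₃ p∤P L₁ L₃ β₁≉β₃)
          (y-differ P Q K x₂ y₂ x₃ y₃ p∤P L₂ L₃ β₂≉β₃)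
        p∣α = proj₁ coefficients
        p∣β = proj₁ (proj₂ coefficients)
        p∣γ = proj₂ (proj₂ coefficients)
        K≢0 : ¬ p∣ K
        K≢0 p∣K = p∤P (p∣square⇒p∣ (∣-by (square-from-γ P K) (∣m∣n⇒∣m-n (∣n⇒∣m*n K p∣K) p∣γ)))
        disc-P² : p∣ t * P - + 2 * Q → p∣ disc A * (P * P)
        disc-P² p∣tP-2Q = ∣-by (disc-from-α t P Q)
          (∣m∣n⇒∣m-n (∣n⇒∣m*n (t * P - + 2 * Q) p∣tP-2Q) (∣n⇒∣m*n (+ 4) p∣α))

    torus-line-no-three : ∀ {g K β₁ β₂ β₃} → ¬ Null g →
      OnTorus β₁ → OnTorus β₂ → OnTorus β₃ →
      p∣ dot g β₁ - K → p∣ dot g β₂ - K → p∣ dot g β₃ - K →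
      ¬ β₁ ≋ β₂ → ¬ β₁ ≋ β₃ → ¬ β₂ ≋ β₃ → ⊥
    torus-line-no-three {P , Q} {K} {x₁ , y₁} {x₂ , y₂} {x₃ , y₃} g≢0 T₁ T₂ T₃ L₁ L₂ L₃ β₁≉β₂ β₁≉β₃ β₂≉β₃ =
      by-cases (p∣? P)
      where
      -- If p ∣ P, exchange the coordinates: the conic x² + t x y + y² = 1 is symmetric in x and y.
      swap-T : ∀ x y → OnTorus (x , y) → OnTorus (y , x)
      swap-T x y = ∣-by (identity t x y)
        where
        identity : ∀ t x y → y * y + t * y * x + x * x - 1ℤ ≡ x * x + t * x * y + y * y - 1ℤ
        identity = solve-∀
      swap-L : ∀ x y → p∣ P * x + Q * y - K → p∣ Q * y + P * x - K
      swap-L x y = ∣-by (identity P Q K x y)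
        where
        identity : ∀ P Q K x y → Q * y + P * x - K ≡ P * x + Q * y - K
        identity = solve-∀
      by-cases : Dec (p∣ P) → ⊥
      by-cases (no p∤P) = line-torus-no-three {P} {Q} {K} {x₁} {y₁} {x₂} {y₂} {x₃} {y₃} p∤P
        T₁ T₂ T₃ L₁ L₂ L₃ β₁≉β₂ β₁≉β₃ β₂≉β₃
      by-cases (yes p∣P) = line-torus-no-three {Q} {P} {K} {y₁} {x₁} {y₂} {x₂} {y₃} {x₃}
        (λ p∣Q → g≢0 (p∣P , p∣Q))
        (swap-T x₁ y₁ T₁) (swap-T x₂ y₂ T₂) (swap-T x₃ y₃ T₃)
        (swap-L x₁ y₁ L₁) (swap-L x₂ y₂ L₂) (swap-L x₃ y₃ L₃)
        (β₁≉β₂ ∘ swap) (β₁≉β₃ ∘ swap) (β₂≉β₃ ∘ swap)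

module Counting (A : Mat2) (det≡1 : IsSL2 A) (N : ℕ) (N-prime : Prime N) where

  open import Data.Nat as ℕ using (suc)
  open import Data.Nat.Divisibility as ℕ-Div using ()
  open import Data.Integer using (ℤ; +_; _+_; _-_; 0ℤ; 1ℤ)
  open import Data.Integer.Divisibility.Signed using (_∣_; ∣ᵤ⇒∣; ∣⇒∣ᵤ; ∣m∣n⇒∣m-n)
  open import Data.Integer.Tactic.RingSolver using (solve-∀)
  open import Data.Fin using (Fin; toℕ)
  import Data.Fin.Properties as Fin
  open import Data.Product using (∃; _×_; _,_; proj₁; proj₂)
  open import Data.Product.Properties using (≡-dec)
  open import Data.Unit using (tt)
  open import Data.Empty using (⊥)
  open import Function using (_∘_)
  open import Relation.Nullary using (¬_)
  open import Relation.Binary.PropositionalEquality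
  open CardinalityBounds
  open Residues using (toℕ-injective-mod; ∣-2*-odd)
  open Forms using (disc; form; dot)
  open Modular N N-prime
  open ModularForms A det≡1 N N-prime

  B : Res N → Mat2
  B β = ι A (lift N β)

  InC⇒OnTorus : ∀ {β} → InC A N β → OnTorus (lift N β)
  InC⇒OnTorus (2N∣norm-1 , _) = ∣ᵤ⇒∣ (ℕ-Div.∣-trans (ℕ-Div.n∣m*n 2) 2N∣norm-1)

  InC-≋-injective : ¬ 2 ℕ-Div.∣ N → ∀ {β β'} → InC A N β → InC A N β' → lift N β ≋ lift N β' → β ≡ β'
  InC-≋-injective N-odd {x , y} {x' , y'} (_ , x≡1 , y≡0) (_ , x'≡1 , y'≡0) (N∣x-x' , N∣y-y') =
    cong₂ _,_ (same-parity {1ℤ} x x' x≡1 x'≡1 N∣x-x') (same-parity {0ℤ} y y' y≡0 y'≡0 N∣y-y')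
    where
    same-parity : ∀ {r : ℤ} (i j : Fin (2 ℕ.* N)) → (+ toℕ i) ≡ r [mod 2 ] → (+ toℕ j) ≡ r [mod 2 ] →
      p∣ + toℕ i - + toℕ j → i ≡ j
    same-parity {r} i j i≡r j≡r N∣i-j = toℕ-injective-mod i j (∣-2*-odd N-odd (∣⇒∣ᵤ 2∣i-j) (∣⇒∣ᵤ N∣i-j))
      where
      identity : ∀ i j r → i - j ≡ (i - r) - (j - r)
      identity = solve-∀
      2∣i-j : + 2 ∣ + toℕ i - + toℕ j
      2∣i-j = subst (+ 2 ∣_) (sym (identity (+ toℕ i) (+ toℕ j) r))
        (∣m∣n⇒∣m-n (∣ᵤ⇒∣ {i = + toℕ i - r} i≡r) (∣ᵤ⇒∣ {i = + toℕ j - r} j≡r))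

  module _ (N-odd : ¬ 2 ℕ-Div.∣ N) (N∤disc : ¬ p∣ disc A) where

    open Torus (p∤2 N-odd) N∤disc

    slope-of : Res N → Fin (suc N)
    slope-of β = proj₁ (slope (proj₁ (lift N β)) (proj₂ (lift N β)))

    card-InC : CardLe (InC A N) (suc N)
    card-InC = cardLe-injection slope-of (λ _ → tt) injective (cardLe-Fin (suc N))
      where
      injective : ∀ {β β'} → InC A N β → InC A N β' → slope-of β ≡ slope-of β' → β ≡ β'
      injective {β@(i , j)} {β'@(i' , j')} β∈C β'∈C same-slope = InC-≋-injective N-odd β∈C β'∈C
        (slope-injective (InC⇒OnTorus {β} β∈C) (InC⇒OnTorus {β'} β'∈C) (proj₂ (slope (+ toℕ i) (+ toℕ j)))
          (subst (Slope (+ toℕ i') (+ toℕ j')) (sym same-slope) (proj₂ (slope (+ toℕ i') (+ toℕ j')))))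

    module _ (k l m n : Vec2) (N∤Ql : ¬ p∣ form A l) (N∤Qm : ¬ p∣ form A m) (N∤Qn : ¬ p∣ form A n) where

      X : Res N × Res N × Res N → Set
      X = InX A k l m n N

      shift : Res N → Vec2
      shift β₂ = vsub (l · B β₂) k

      X-relation : ∀ {β₂ β₃ β₄} → X (β₂ , β₃ , β₄) → vsub (m · B β₃) (shift β₂) ≋ n · B β₄
      X-relation {β₂} {β₃} {β₄} (_ , _ , _ , N∣E₁ , N∣E₂) =
        ∣-by (identity (proj₁ k) (proj₁ L) (proj₁ U) (proj₁ Z)) (∣ᵤ⇒∣ N∣E₁) ,
        ∣-by (identity (proj₂ k) (proj₂ L) (proj₂ U) (proj₂ Z)) (∣ᵤ⇒∣ N∣E₂)
        where
        L = l · B β₂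
        U = m · B β₃
        Z = n · B β₄
        identity : ∀ k L U Z → (U - (L - k)) - Z ≡ ((k - L) + U - Z) - 0ℤ
        identity = solve-∀

      β₄-determined : ∀ {β₂ β₃ β₄ β₄'} → X (β₂ , β₃ , β₄) → X (β₂ , β₃ , β₄') → β₄ ≡ β₄'
      β₄-determined {β₂} {β₃} {β₄} {β₄'} x@(_ , _ , β₄∈C , _) x'@(_ , _ , β₄'∈C , _) =
        InC-≋-injective N-odd β₄∈C β₄'∈C (·ι-cancel (lift N β₄) (lift N β₄') N∤Qn
          (≋-trans {n · B β₄} {vsub (m · B β₃) (shift β₂)}
            (≋-sym {vsub (m · B β₃) (shift β₂)} (X-relation x)) (X-relation x')))

      X-≡-from-β₂β₃ : ∀ {β₂ β₃ β₄ β₂' β₃' β₄'} → X (β₂ , β₃ , β₄) → X (β₂' , β₃' , β₄') →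
        β₂ ≡ β₂' → β₃ ≡ β₃' → (β₂ , β₃ , β₄) ≡ (β₂' , β₃' , β₄')
      X-≡-from-β₂β₃ x x' refl refl = cong (λ β₄ → _ , _ , β₄) (β₄-determined x x')

      ShiftVanishes : Res N → Set
      ShiftVanishes β₂ = l · B β₂ ≋ k

      card-X-vanishing : CardLe (λ τ → X τ × ShiftVanishes (proj₁ τ)) (suc N)
      card-X-vanishing = cardLe-injection (proj₁ ∘ proj₂) (λ ((_ , β₃∈C , _) , _) → β₃∈C) injective card-InC
        where
        injective : ∀ {τ τ'} → X τ × ShiftVanishes (proj₁ τ) → X τ' × ShiftVanishes (proj₁ τ') →
          proj₁ (proj₂ τ) ≡ proj₁ (proj₂ τ') → τ ≡ τ'
        injective {β₂ , _} {β₂' , _} (x@(β₂∈C , _) , lβ₂≋k) (x'@(β₂'∈C , _) , lβ₂'≋k) same-β₃ =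
          X-≡-from-β₂β₃ x x' (InC-≋-injective N-odd β₂∈C β₂'∈C (·ι-cancel (lift N β₂) (lift N β₂') N∤Ql
            (≋-trans {l · B β₂} {k} lβ₂≋k (≋-sym {l · B β₂'} lβ₂'≋k)))) same-β₃

      Partner : Res N → Res N → Set
      Partner β₂ β₃ = ¬ ShiftVanishes β₂ × ∃ λ β₄ → X (β₂ , β₃ , β₄)

      partners-≤2 : ∀ β₂ → CardLe (Partner β₂) 2
      partners-≤2 β₂ = cardLe-2 no-three
        where
        v = shift β₂
        on-line : ∀ {β₃ β₄} → X (β₂ , β₃ , β₄) → p∣ dot (line-normal m v) (lift N β₃) -
          (form A m + form A v - form A n)
        on-line {β₃} {β₄} x@(_ , β₃∈C , β₄∈C , _) =
          line-through m n v {lift N β₃} {lift N β₄} (InC⇒OnTorus {β₃} β₃∈C) (InC⇒OnTorus {β₄} β₄∈C)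
            (X-relation x)
        no-three : ∀ {β β' β''} → Partner β₂ β → Partner β₂ β' → Partner β₂ β'' → β ≢ β' → β ≢ β'' →
          β' ≢ β'' → ⊥
        no-three {β} {β'} {β''} (v≢0 , _ , x@(_ , β∈C , _)) (_ , _ , x'@(_ , β'∈C , _))
          (_ , _ , x''@(_ , β''∈C , _))
          β≢β' β≢β'' β'≢β'' =
          torus-line-no-three (v≢0 ∘ line-normal-nondegenerate N∤disc N∤Qm)
            (InC⇒OnTorus {β} β∈C) (InC⇒OnTorus {β'} β'∈C) (InC⇒OnTorus {β''} β''∈C)
            (on-line x) (on-line x') (on-line x'')
            (β≢β' ∘ InC-≋-injective N-odd β∈C β'∈C) (β≢β'' ∘ InC-≋-injective N-odd β∈C β''∈C)
            (β'≢β'' ∘ InC-≋-injective N-odd β'∈C β''∈C)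

      card-X-non-vanishing : CardLe (λ τ → X τ × ¬ ShiftVanishes (proj₁ τ)) (suc N ℕ.* 2)
      card-X-non-vanishing =
        cardLe-injection (λ (β₂ , β₃ , _) → β₂ , β₃) (λ (x@(β₂∈C , _) , v≢0) → β₂∈C , v≢0 , _ , x) injective
          (cardLe-fibres (≡-dec Fin._≟_ Fin._≟_) card-InC partners-≤2)
        where
        injective : ∀ {τ τ'} → X τ × ¬ ShiftVanishes (proj₁ τ) → X τ' × ¬ ShiftVanishes (proj₁ τ') →
          (proj₁ τ , proj₁ (proj₂ τ)) ≡ (proj₁ τ' , proj₁ (proj₂ τ')) → τ ≡ τ'
        injective (x , _) (x' , _) same = X-≡-from-β₂β₃ x x' (cong proj₁ same) (cong proj₂ same)

      card-InX : CardLe X (suc N ℕ.+ suc N ℕ.* 2)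
      card-InX = cardLe-split (λ (β₂ , _) → l · B β₂ ≋? k) card-X-vanishing card-X-non-vanishing

module LargePrimes (A : Mat2) (det≡1 : IsSL2 A) (hyp : Hyperbolic A) where

  open import Data.Nat as ℕ using (suc; _<_; _≤_; _⊔_; s≤s)
  open import Data.Nat.Divisibility using (_∣_)
  import Data.Nat.Properties as ℕP
  open import Data.Integer using (ℤ; _+_; _-_; _*_; ∣_∣; 0ℤ)
  open import Data.Integer.Divisibility.Signed using (divides; ∣⇒∣ᵤ)
  open import Data.Integer.Tactic.RingSolver using (solve-∀)
  open import Data.Product using (_×_; _,_)
  open import Relation.Nullary using (¬_)
  open import Relation.Binary.PropositionalEquality
  open Forms using (disc; disc≢0; form; form-anisotropic)

  threshold : Vec2 → Vec2 → Vec2 → ℕ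
  threshold l m n = suc (∣ disc A ∣ ⊔ ∣ form A l ∣ ⊔ ∣ form A m ∣ ⊔ ∣ form A n ∣)

  below-threshold : ∀ {l m n N} → threshold l m n ≤ N →
    ∣ disc A ∣ < N × ∣ form A l ∣ < N × ∣ form A m ∣ < N × ∣ form A n ∣ < N
  below-threshold {l} {m} {n} N₀≤N =
    < (ℕP.≤-trans (ℕP.m≤m⊔n D L) (ℕP.≤-trans (ℕP.m≤m⊔n (D ⊔ L) M) (ℕP.m≤m⊔n (D ⊔ L ⊔ M) Nn))) ,
    < (ℕP.≤-trans (ℕP.m≤n⊔m D L) (ℕP.≤-trans (ℕP.m≤m⊔n (D ⊔ L) M) (ℕP.m≤m⊔n (D ⊔ L ⊔ M) Nn))) ,
    < (ℕP.≤-trans (ℕP.m≤n⊔m (D ⊔ L) M) (ℕP.m≤m⊔n (D ⊔ L ⊔ M) Nn)) ,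
    < (ℕP.m≤n⊔m (D ⊔ L ⊔ M) Nn)
    where
    D = ∣ disc A ∣
    L = ∣ form A l ∣
    M = ∣ form A m ∣
    Nn = ∣ form A n ∣
    < : ∀ {z} → z ≤ D ⊔ L ⊔ M ⊔ Nn → z < _
    < z≤max = ℕP.<-≤-trans (s≤s z≤max) N₀≤N

  module _ {N : ℕ} (N-prime : Prime N) where

    open Modular N N-prime

    disc-nonvanishing : ∣ disc A ∣ < N → ¬ p∣ disc A
    disc-nonvanishing ∣disc∣<N N∣disc = disc≢0 A hyp (∣-small⇒≡0 N∣disc ∣disc∣<N)

    form-nonvanishing : ∀ w → ∣ form A w ∣ < N → ¬ (Q A w ≡ 0ℤ [mod N ]) → ¬ p∣ form A w
    form-nonvanishing w ∣Qw∣<N Qw≢0 N∣Qw = Qw≢0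
      (subst (λ v → Q A v ≡ 0ℤ [mod N ]) (sym (form-anisotropic A det≡1 hyp w (∣-small⇒≡0 N∣Qw ∣Qw∣<N)))
        (∣⇒∣ᵤ (∣-by (identity (a A) (b A) (c A) (d A)) (divides 0ℤ refl))))
      where
      identity : ∀ a b c d → c * 0ℤ * 0ℤ + (d - a) * 0ℤ * 0ℤ - b * 0ℤ * 0ℤ - 0ℤ ≡ 0ℤ
      identity = solve-∀

  card-InX-beyond-threshold : ∀ k l m n {N} → threshold l m n ≤ N → Prime N → ¬ 2 ∣ N →
    ¬ (Q A l ≡ 0ℤ [mod N ]) → ¬ (Q A m ≡ 0ℤ [mod N ]) → ¬ (Q A n ≡ 0ℤ [mod N ]) →
    CardLe (InX A k l m n N) (suc N ℕ.+ suc N ℕ.* 2)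
  card-InX-beyond-threshold k l m n {N} N₀≤N N-prime N-odd Ql≢0 Qm≢0 Qn≢0
    with ∣disc∣<N , ∣Ql∣<N , ∣Qm∣<N , ∣Qn∣<N ← below-threshold {l} {m} {n} N₀≤N =
    Counting.card-InX A det≡1 N N-prime N-odd (disc-nonvanishing N-prime ∣disc∣<N) k l m n
      (form-nonvanishing N-prime l ∣Ql∣<N Ql≢0) (form-nonvanishing N-prime m ∣Qm∣<N Qm≢0)
      (form-nonvanishing N-prime n ∣Qn∣<N Qn≢0)

open import Data.Nat using (suc; _≤_; _+_; _*_)
open import Data.Nat.Divisibility using (_∣_)
open import Data.Integer using (0ℤ)
open import Data.Product using (∃-syntax; _,_)
open import Relation.Nullary using (¬_)
open import Relation.Binary.PropositionalEquality using (_≡_; subst)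
import Data.Nat.Tactic.RingSolver as ℕ-Solver

private
  3[N+1] : ∀ N → suc N + suc N * 2 ≡ 3 * (N + 1)
  3[N+1] = ℕ-Solver.solve-∀

lemma5p5 : (A : Mat2) → IsSL2 A → Hyperbolic A → ≡I-mod2 A →
    (k l m n : Vec2) →
    ∃[ N₀ ] ((N : ℕ) → N₀ ≤ N → Prime N → ¬ (2 ∣ N) →
    ¬ (Q A k ≡ 0ℤ [mod N ]) → ¬ (Q A l ≡ 0ℤ [mod N ]) →
    ¬ (Q A m ≡ 0ℤ [mod N ]) → ¬ (Q A n ≡ 0ℤ [mod N ]) →
    CardLe (InX A k l m n N) (3 * (N + 1)))
lemma5p5 A det≡1 hyp _ k l m n = threshold l m n , λ N N₀≤N N-prime N-odd _ Ql≢0 Qm≢0 Qn≢0 →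
  subst (CardLe (InX A k l m n N)) (3[N+1] N)
    (card-InX-beyond-threshold k l m n N₀≤N N-prime N-odd Ql≢0 Qm≢0 Qn≢0)
  where open LargePrimes A det≡1 hyp
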